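{- Let $n\ge0$, let $a_0$ be an integer and let $a_1,\ldots,a_n,b_1,b_2,\ldots,c_1,c_2,\ldots$ be positive integers with $b_1\ne c_1$, and put $\alpha=[a_0;a_1,\ldots,a_n,b_1,b_2,\ldots]$, $\beta=[a_0;a_1,\ldots,a_n,c_1,c_2,\ldots]$. Suppose all partial quotients of $\alpha$ and $\beta$ do not exceed $4$. Then $$\delta_n<|\alpha-\beta|<\varepsilon_n,\qquad\text{where } \delta_n=5^{ -2(n+2)},\ \varepsilon_n=2^{ -(n-1)}.$$ -}

module Defs where

open import Data.Nat using (ℕ; zero; suc; _+_; _*_; _∸_; _^_; _<?_; _≥_)
open import Data.Integer using (ℤ; +_)
import Data.Integer as ℤ
open import Data.Product using (_×_; _,_; proj₁; proj₂; ∃-syntax)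
open import Data.Vec using (Vec; lookup)
open import Data.Fin using (fromℕ<)
open import Relation.Nullary using (yes; no)
open import Data.Rational.Unnormalised using (ℚᵘ; mkℚᵘ; _-_; ∣_∣; _<_; _≤_)

-- The sequence of partial quotients a₁,…,aₙ,t₁,t₂,… (0-indexed):
-- splice a t k = a_{k+1} for k < n, and t_{k-n+1} for k ≥ n.
splice : ∀ {n} → Vec ℕ n → (ℕ → ℕ) → ℕ → ℕ
splice {n} a t k with k <? n
... | yes k<n = lookup a (fromℕ< k<n)
... | no _ = t (k ∸ n)

pq : ℤ → (ℕ → ℕ) → ℕ → (ℤ × ℕ) × (ℤ × ℕ)
pq x₀ x zero = (x₀ , 1) , (+ 1 , 0)
pq x₀ x (suc m) with pq x₀ x m
... | (p , q) , (p' , q') = (+ (x m) ℤ.* p ℤ.+ p' , x m * q + q') , (p , q)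

-- The m-th convergent p_m / q_m = [x₀ ; x 0 , … , x (m-1)] as a rational.
-- (When all x k ≥ 1 we have q_m ≥ 1, so mkℚᵘ p_m (q_m ∸ 1) is exactly p_m / q_m.)
convergent : ℤ → (ℕ → ℕ) → ℕ → ℚᵘ
convergent x₀ x m = mkℚᵘ (proj₁ (proj₁ (pq x₀ x m))) (proj₂ (proj₁ (pq x₀ x m)) ∸ 1)

-- For convergent (Cauchy) sequences s → σ and t → τ of rationals, the real-number
-- statements |σ - τ| < ε and |σ - τ| > δ (ε, δ rational) are, by definition of
-- the order on limits:
LimDist< : (ℕ → ℚᵘ) → (ℕ → ℚᵘ) → ℚᵘ → Set
LimDist< s t ε = ∃[ r ] (r < ε × ∃[ N ] (∀ m → m ≥ N → ∣ s m - t m ∣ ≤ r))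

LimDist> : (ℕ → ℚᵘ) → (ℕ → ℚᵘ) → ℚᵘ → Set
LimDist> s t δ = ∃[ r ] (δ < r × ∃[ N ] (∀ m → m ≥ N → r ≤ ∣ s m - t m ∣))

δ : ℕ → ℚᵘ
δ n = mkℚᵘ (+ 1) (5 ^ (2 * (n + 2)) ∸ 1)

ε : ℕ → ℚᵘ
ε zero = mkℚᵘ (+ 2) 0
ε (suc m) = mkℚᵘ (+ 1) (2 ^ m ∸ 1)

module Submission where

open import Defs

open import Data.Rational.Unnormalised using (ℚᵘ; mkℚᵘ)
import Data.Rational.Unnormalised as ℚ
open import Data.Fin using (fromℕ<)
open import Data.Vec using (Vec)
open import Data.Vec.Relation.Unary.All using (All)
open import Data.Vec.Relation.Unary.All.Properties using (lookup⁺)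
open import Data.List using ([]; _∷_)
open import Data.Nat using (ℕ; zero; suc; _+_; _*_; _∸_; _^_; _≤_; _<_; z≤n; s≤s; ∣_-_∣; >-nonZero; _<?_)
open import Data.Nat.Properties
open import Algebra.Properties.CommutativeSemigroup *-commutativeSemigroup using (x∙yz≈y∙xz; xy∙z≈y∙xz)
open import Data.Nat.Tactic.RingSolver using (solve-∀; solve)
open import Function using (_∘_)
open import Data.Product using (_×_; _,_; proj₁; proj₂)
open import Data.Integer using (ℤ; +_)
import Data.Integer as ℤ
import Data.Integer.Properties as ℤ
import Data.Integer.Tactic.RingSolver as ℤ-Solver
open import Data.Sum using (inj₁; inj₂)
open import Relation.Binary.Definitions using (tri<; tri≈; tri>)
open import Relation.Binary.PropositionalEquality
open import Relation.Nullary using (yes; no; contradiction)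

-- Let q_m, p_m be the continuants of [0; x 0, x 1, …], so that the m-th convergent is
-- a₀ + p_m / q_m, and q̃_m, p̃_m those of y. Two convergents with the same a₀ differ by
-- |q_m p̃_m − q̃_m p_m| / (q_m q̃_m). If x and y agree below n, the recurrence from level n on is
-- linear in the level-n data, so by Cauchy–Binet and |q_n p_{n−1} − q_{n−1} p_n| = 1 this cross
-- determinant equals that of the tails b = x (n + ·) and c = y (n + ·). A tail fraction with
-- quotients in [1, M] lies in [1/(M+1), 1], so the tail determinant is at most M/(M+1) times the
-- product of the tail denominators; and if b 0 < c 0 the two tail fractions are separated by a gap
-- forcing it to be at least 1/(M+1)³ times that product. As q_n · q_tail ≤ q_{n+k} ≤ 2 q_n · q_tail,
-- the distance lies in [1/(500 q_n²), 4/(5 q_n²)] from level n + 2 on, and 1 ≤ q_n ≤ 5ⁿ and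
-- 2ⁿ ≤ 2 q_n² compare these bounds with δ_n and ε_n.

∣-∣≡∣+-+∣ : ∀ m n → ∣ m - n ∣ ≡ ℤ.∣ + m ℤ.- + n ∣
∣-∣≡∣+-+∣ m n with ≤-total m n
... | inj₁ m≤n = begin
  ∣ m - n ∣            ≡⟨ m≤n⇒∣m-n∣≡n∸m m≤n ⟩
  n ∸ m                ≡⟨ ℤ.∣⊖∣-≤ m≤n ⟨
  ℤ.∣ m ℤ.⊖ n ∣        ≡⟨ cong ℤ.∣_∣ (ℤ.[+m]-[+n]≡m⊖n m n) ⟨
  ℤ.∣ + m ℤ.- + n ∣    ∎
  where open ≡-Reasoning
... | inj₂ n≤m = begin
  ∣ m - n ∣            ≡⟨ m≤n⇒∣n-m∣≡n∸m n≤m ⟩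
  m ∸ n                ≡⟨ ℤ.∣⊖∣-≤ n≤m ⟨
  ℤ.∣ n ℤ.⊖ m ∣        ≡⟨ ℤ.∣m⊖n∣≡∣n⊖m∣ n m ⟩
  ℤ.∣ m ℤ.⊖ n ∣        ≡⟨ cong ℤ.∣_∣ (ℤ.[+m]-[+n]≡m⊖n m n) ⟨
  ℤ.∣ + m ℤ.- + n ∣    ∎
  where open ≡-Reasoning

∣-∣≤∸ : ∀ {l u x y} → l ≤ x → x ≤ u → l ≤ y → y ≤ u → ∣ x - y ∣ ≤ u ∸ l
∣-∣≤∸ {x = x} {y} l≤x x≤u l≤y y≤u with ≤-total x y
... | inj₁ x≤y = ≤-trans (≤-reflexive (m≤n⇒∣m-n∣≡n∸m x≤y)) (∸-mono y≤u l≤x)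
... | inj₂ y≤x = ≤-trans (≤-reflexive (m≤n⇒∣n-m∣≡n∸m y≤x)) (∸-mono x≤u l≤y)

m+n≤o⇒n≤∣m-o∣ : ∀ m n o → m + n ≤ o → n ≤ ∣ m - o ∣
m+n≤o⇒n≤∣m-o∣ m n o m+n≤o = begin
  n          ≤⟨ m+n≤o⇒m≤o∸n n (≤-trans (≤-reflexive (+-comm n m)) m+n≤o) ⟩
  o ∸ m      ≤⟨ m∸n≤∣m-n∣ o m ⟩
  ∣ o - m ∣  ≡⟨ ∣-∣-comm o m ⟩
  ∣ m - o ∣  ∎
  where open ≤-Reasoning

step : ℕ → ℕ × ℕ → ℕ × ℕ
step a (u , u′) = a * u + u′ , u

continuant : (ℕ → ℕ) → ℕ × ℕ → ℕ → ℕ × ℕ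
continuant t u zero    = u
continuant t u (suc k) = step (t k) (continuant t u k)

drop : ℕ → (ℕ → ℕ) → ℕ → ℕ
drop m t i = t (m + i)

-- The denominator q_k and numerator p_k of [0; t 0, …, t (k ∸ 1)].
den num : (ℕ → ℕ) → ℕ → ℕ
den t k = proj₁ (continuant t (1 , 0) k)
num t k = proj₁ (continuant t (0 , 1) k)

frac : (ℕ → ℕ) → ℕ → ℕ × ℕ
frac t k = den t k , num t k

⟨_,_⟩ : ℕ × ℕ → ℕ × ℕ → ℕ
⟨ σ , u ⟩ = proj₁ σ * proj₁ u + proj₂ σ * proj₂ u

det : ℕ × ℕ → ℕ × ℕ → ℕ
det u w = ∣ proj₁ u * proj₂ w - proj₂ u * proj₁ w ∣

continuant-+ : ∀ t u m k → continuant t u (m + k) ≡ continuant (drop m t) (continuant t u m) k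
continuant-+ t u m zero    = cong (continuant t u) (+-identityʳ m)
continuant-+ t u m (suc k) rewrite +-suc m k = cong (step (t (m + k))) (continuant-+ t u m k)

continuant-cong : ∀ {x y} u m → (∀ i → i < m → x i ≡ y i) → continuant x u m ≡ continuant y u m
continuant-cong u zero    agree = refl
continuant-cong u (suc m) agree =
  cong₂ step (agree m ≤-refl) (continuant-cong u m (λ i i<m → agree i (m<n⇒m<1+n i<m)))

combine : ℕ × ℕ → ℕ × ℕ → ℕ × ℕ → ℕ × ℕ
combine σ u w = ⟨ σ , (proj₁ u , proj₁ w) ⟩ , ⟨ σ , (proj₂ u , proj₂ w) ⟩

step-combine : ∀ a σ u w → step a (combine σ u w) ≡ combine σ (step a u) (step a w)
step-combine a (s , s′) (u , u′) (w , w′) = cong (_, s * u + s′ * w) distribute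
  where
  distribute : a * (s * u + s′ * w) + (s * u′ + s′ * w′) ≡ s * (a * u + u′) + s′ * (a * w + w′)
  distribute = solve (a ∷ s ∷ s′ ∷ u ∷ u′ ∷ w ∷ w′ ∷ [])

continuant-combine : ∀ t σ k →
  continuant t σ k ≡ combine σ (continuant t (1 , 0) k) (continuant t (0 , 1) k)
continuant-combine t (s , s′) zero = cong₂ _,_ first second
  where
  first : s ≡ s * 1 + s′ * 0
  first = solve (s ∷ s′ ∷ [])
  second : s′ ≡ s * 0 + s′ * 1
  second = solve (s ∷ s′ ∷ [])
continuant-combine t σ (suc k) =
  trans (cong (step (t k)) (continuant-combine t σ k)) (step-combine (t k) σ _ _)

proj₁-continuant : ∀ t σ k → proj₁ (continuant t σ k) ≡ ⟨ σ , frac t k ⟩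
proj₁-continuant t σ k = cong proj₁ (continuant-combine t σ k)

frac-+ : ∀ t m k →
  frac t (m + k) ≡ (⟨ continuant t (1 , 0) m , frac (drop m t) k ⟩ ,
                    ⟨ continuant t (0 , 1) m , frac (drop m t) k ⟩)
frac-+ t m k = cong₂ _,_ (expand (1 , 0)) (expand (0 , 1))
  where
  expand : ∀ u → proj₁ (continuant t u (m + k)) ≡ ⟨ continuant t u m , frac (drop m t) k ⟩
  expand u = trans (cong proj₁ (continuant-+ t u m k)) (proj₁-continuant (drop m t) (continuant t u m) k)

den-suc : ∀ t k → den t (suc k) ≡ t 0 * den (drop 1 t) k + num (drop 1 t) k
den-suc t k = begin
  den t (1 + k)                                             ≡⟨ cong proj₁ (continuant-+ t (1 , 0) 1 k) ⟩
  proj₁ (continuant (drop 1 t) (t 0 * 1 + 0 , 1) k)        ≡⟨ proj₁-continuant (drop 1 t) _ k ⟩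
  (t 0 * 1 + 0) * den (drop 1 t) k + 1 * num (drop 1 t) k  ≡⟨ simplify (t 0) _ _ ⟩
  t 0 * den (drop 1 t) k + num (drop 1 t) k                 ∎
  where
  open ≡-Reasoning
  simplify : ∀ a d n → (a * 1 + 0) * d + 1 * n ≡ a * d + n
  simplify = solve-∀

num-suc : ∀ t k → num t (suc k) ≡ den (drop 1 t) k
num-suc t k = begin
  num t (1 + k)                                             ≡⟨ cong proj₁ (continuant-+ t (0 , 1) 1 k) ⟩
  proj₁ (continuant (drop 1 t) (t 0 * 0 + 1 , 0) k)        ≡⟨ proj₁-continuant (drop 1 t) _ k ⟩
  (t 0 * 0 + 1) * den (drop 1 t) k + 0 * num (drop 1 t) k  ≡⟨ simplify (t 0) _ (num (drop 1 t) k) ⟩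
  den (drop 1 t) k                                          ∎
  where
  open ≡-Reasoning
  simplify : ∀ a d n → (a * 0 + 1) * d + 0 * n ≡ d
  simplify = solve-∀

det-step : ∀ a u w → det (step a u) (step a w) ≡ det u w
det-step a (v , v′) (z , z′) = begin
  ∣ (a * v + v′) * z - v * (a * z + z′) ∣      ≡⟨ cong₂ ∣_-_∣ (expand₁ a v v′ z) (expand₂ a v z z′) ⟩
  ∣ a * v * z + v′ * z - a * v * z + v * z′ ∣  ≡⟨ ∣m+n-m+o∣≡∣n-o∣ (a * v * z) _ _ ⟩
  ∣ v′ * z - v * z′ ∣                          ≡⟨ ∣-∣-comm (v′ * z) _ ⟩
  ∣ v * z′ - v′ * z ∣                          ∎
  where
  open ≡-Reasoning
  expand₁ : ∀ a v v′ z → (a * v + v′) * z ≡ a * v * z + v′ * z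
  expand₁ = solve-∀
  expand₂ : ∀ a v z z′ → v * (a * z + z′) ≡ a * v * z + v * z′
  expand₂ = solve-∀

det-continuant : ∀ t u w k → det (continuant t u k) (continuant t w k) ≡ det u w
det-continuant t u w zero    = refl
det-continuant t u w (suc k) =
  trans (det-step (t k) (continuant t u k) (continuant t w k)) (det-continuant t u w k)

det-comm : ∀ u w → det u w ≡ det w u
det-comm (a , c) (b , d) = begin
  ∣ a * d - c * b ∣  ≡⟨ ∣-∣-comm (a * d) (c * b) ⟩
  ∣ c * b - a * d ∣  ≡⟨ cong₂ ∣_-_∣ (*-comm c b) (*-comm a d) ⟩
  ∣ b * c - d * a ∣  ∎
  where open ≡-Reasoning

det≡∣det∣ : ∀ u w → det u w ≡ ℤ.∣ + proj₁ u ℤ.* + proj₂ w ℤ.- + proj₂ u ℤ.* + proj₁ w ∣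
det≡∣det∣ (u , u′) (w , w′) = begin
  ∣ u * w′ - u′ * w ∣                   ≡⟨ ∣-∣≡∣+-+∣ (u * w′) (u′ * w) ⟩
  ℤ.∣ + (u * w′) ℤ.- + (u′ * w) ∣       ≡⟨ cong ℤ.∣_∣ (cong₂ ℤ._-_ (ℤ.pos-* u w′) (ℤ.pos-* u′ w)) ⟩
  ℤ.∣ + u ℤ.* + w′ ℤ.- + u′ ℤ.* + w ∣   ∎
  where open ≡-Reasoning

+⟨⟩ : ∀ σ u → + ⟨ σ , u ⟩ ≡ + proj₁ σ ℤ.* + proj₁ u ℤ.+ + proj₂ σ ℤ.* + proj₂ u
+⟨⟩ (s , s′) (u , u′) = trans (ℤ.pos-+ (s * u) (s′ * u′)) (cong₂ ℤ._+_ (ℤ.pos-* s u) (ℤ.pos-* s′ u′))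

det-⟨⟩ : ∀ σ τ u w → det (⟨ σ , u ⟩ , ⟨ τ , u ⟩) (⟨ σ , w ⟩ , ⟨ τ , w ⟩) ≡ det σ τ * det u w
det-⟨⟩ σ@(s , s′) τ@(r , r′) u@(u₁ , u₂) w@(w₁ , w₂) = begin
  det (⟨ σ , u ⟩ , ⟨ τ , u ⟩) (⟨ σ , w ⟩ , ⟨ τ , w ⟩)
    ≡⟨ det≡∣det∣ (⟨ σ , u ⟩ , ⟨ τ , u ⟩) (⟨ σ , w ⟩ , ⟨ τ , w ⟩) ⟩
  ℤ.∣ + ⟨ σ , u ⟩ ℤ.* + ⟨ τ , w ⟩ ℤ.- + ⟨ τ , u ⟩ ℤ.* + ⟨ σ , w ⟩ ∣
    ≡⟨ cong ℤ.∣_∣ (cong₂ ℤ._-_ (cong₂ ℤ._*_ (+⟨⟩ σ u) (+⟨⟩ τ w))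
                              (cong₂ ℤ._*_ (+⟨⟩ τ u) (+⟨⟩ σ w))) ⟩
  ℤ.∣ (S ℤ.* U₁ ℤ.+ S′ ℤ.* U₂) ℤ.* (R ℤ.* W₁ ℤ.+ R′ ℤ.* W₂)
      ℤ.- (R ℤ.* U₁ ℤ.+ R′ ℤ.* U₂) ℤ.* (S ℤ.* W₁ ℤ.+ S′ ℤ.* W₂) ∣
    ≡⟨ cong ℤ.∣_∣ (binet S S′ R R′ U₁ U₂ W₁ W₂) ⟩
  ℤ.∣ (S ℤ.* R′ ℤ.- S′ ℤ.* R) ℤ.* (U₁ ℤ.* W₂ ℤ.- U₂ ℤ.* W₁) ∣
    ≡⟨ ℤ.abs-* (S ℤ.* R′ ℤ.- S′ ℤ.* R) (U₁ ℤ.* W₂ ℤ.- U₂ ℤ.* W₁) ⟩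
  ℤ.∣ S ℤ.* R′ ℤ.- S′ ℤ.* R ∣ * ℤ.∣ U₁ ℤ.* W₂ ℤ.- U₂ ℤ.* W₁ ∣
    ≡⟨ cong₂ _*_ (det≡∣det∣ σ τ) (det≡∣det∣ u w) ⟨
  det σ τ * det u w ∎
  where
  open ≡-Reasoning
  S = + s ; S′ = + s′ ; R = + r ; R′ = + r′ ; U₁ = + u₁ ; U₂ = + u₂ ; W₁ = + w₁ ; W₂ = + w₂
  binet : ∀ s s′ r r′ u₁ u₂ w₁ w₂ →
    (s ℤ.* u₁ ℤ.+ s′ ℤ.* u₂) ℤ.* (r ℤ.* w₁ ℤ.+ r′ ℤ.* w₂)
      ℤ.- (r ℤ.* u₁ ℤ.+ r′ ℤ.* u₂) ℤ.* (s ℤ.* w₁ ℤ.+ s′ ℤ.* w₂)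
      ≡ (s ℤ.* r′ ℤ.- s′ ℤ.* r) ℤ.* (u₁ ℤ.* w₂ ℤ.- u₂ ℤ.* w₁)
  binet = ℤ-Solver.solve-∀

det-common-prefix : ∀ x y n k → (∀ i → i < n → x i ≡ y i) →
  det (frac x (n + k)) (frac y (n + k)) ≡ det (frac (drop n x) k) (frac (drop n y) k)
det-common-prefix x y n k agree = begin
  det (frac x (n + k)) (frac y (n + k))
    ≡⟨ cong₂ det (frac-+ x n k) (frac-+ y n k) ⟩
  det (⟨ σ x , u ⟩ , ⟨ τ x , u ⟩) (⟨ σ y , w ⟩ , ⟨ τ y , w ⟩)
    ≡⟨ cong₂ (λ σ′ τ′ → det (⟨ σ x , u ⟩ , ⟨ τ x , u ⟩) (⟨ σ′ , w ⟩ , ⟨ τ′ , w ⟩))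
             (continuant-cong (1 , 0) n agree) (continuant-cong (0 , 1) n agree) ⟨
  det (⟨ σ x , u ⟩ , ⟨ τ x , u ⟩) (⟨ σ x , w ⟩ , ⟨ τ x , w ⟩)
    ≡⟨ det-⟨⟩ (σ x) (τ x) u w ⟩
  det (σ x) (τ x) * det u w
    ≡⟨ cong (_* det u w) (det-continuant x (1 , 0) (0 , 1) n) ⟩
  1 * det u w
    ≡⟨ *-identityˡ (det u w) ⟩
  det u w ∎
  where
  open ≡-Reasoning
  σ τ : (ℕ → ℕ) → ℕ × ℕ
  σ t = continuant t (1 , 0) n
  τ t = continuant t (0 , 1) n
  u = frac (drop n x) k
  w = frac (drop n y) k

Positive : (ℕ → ℕ) → Set
Positive t = ∀ i → 1 ≤ t i

Bounded : ℕ → (ℕ → ℕ) → Set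
Bounded M t = ∀ i → t i ≤ M

den-drop≤den : ∀ {t} → Positive t → ∀ k → den (drop 1 t) k ≤ den t (suc k)
den-drop≤den {t} pos k = begin
  den (drop 1 t) k                           ≤⟨ m≤n*m _ (t 0) {{>-nonZero (pos 0)}} ⟩
  t 0 * den (drop 1 t) k                     ≤⟨ m≤m+n _ _ ⟩
  t 0 * den (drop 1 t) k + num (drop 1 t) k  ≡⟨ den-suc t k ⟨
  den t (suc k)                              ∎
  where open ≤-Reasoning

num≤den : ∀ {t} → Positive t → ∀ k → num t k ≤ den t k
num≤den         pos zero    = z≤n
num≤den {t} pos (suc k) = begin
  num t (suc k)     ≡⟨ num-suc t k ⟩
  den (drop 1 t) k  ≤⟨ den-drop≤den pos k ⟩
  den t (suc k)     ∎
  where open ≤-Reasoning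

den≤[1+M]*num : ∀ {t M} → Positive t → Bounded M t → ∀ k → den t (suc k) ≤ suc M * num t (suc k)
den≤[1+M]*num {t} {M} pos bounded k = begin
  den t (suc k)                              ≡⟨ den-suc t k ⟩
  t 0 * den (drop 1 t) k + num (drop 1 t) k  ≤⟨ +-mono-≤ (*-monoˡ-≤ _ (bounded 0)) (num≤den (pos ∘ suc) k) ⟩
  M * den (drop 1 t) k + den (drop 1 t) k    ≡⟨ +-comm (M * den (drop 1 t) k) _ ⟩
  suc M * den (drop 1 t) k                   ≡⟨ cong (suc M *_) (num-suc t k) ⟨
  suc M * num t (suc k)                      ∎
  where open ≤-Reasoning

den-pos : ∀ {t} → Positive t → ∀ k → 1 ≤ den t k
den-pos pos zero    = ≤-refl
den-pos pos (suc k) = ≤-trans (den-pos (pos ∘ suc) k) (den-drop≤den pos k)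

den≤[1+M]^ : ∀ {t M} → Positive t → Bounded M t → ∀ k → den t k ≤ suc M ^ k
den≤[1+M]^         pos bounded zero    = ≤-refl
den≤[1+M]^ {t} {M} pos bounded (suc k) = begin
  den t (suc k)             ≤⟨ den≤[1+M]*num pos bounded k ⟩
  suc M * num t (suc k)     ≡⟨ cong (suc M *_) (num-suc t k) ⟩
  suc M * den (drop 1 t) k  ≤⟨ *-monoʳ-≤ (suc M) (den≤[1+M]^ (pos ∘ suc) (bounded ∘ suc) k) ⟩
  suc M * suc M ^ k         ∎
  where open ≤-Reasoning

den+den≤den : ∀ {t} → Positive t → ∀ k → den (drop 2 t) k + den (drop 2 t) k ≤ den t (2 + k)
den+den≤den {t} pos k = begin
  den (drop 2 t) k + den (drop 2 t) k              ≤⟨ +-monoˡ-≤ _ (den-drop≤den (pos ∘ suc) k) ⟩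
  den (drop 1 t) (1 + k) + den (drop 2 t) k        ≡⟨ cong (λ n → den (drop 1 t) (1 + k) + n) (num-suc (drop 1 t) k) ⟨
  den (drop 1 t) (1 + k) + num (drop 1 t) (1 + k)  ≤⟨ +-monoˡ-≤ _ (m≤n*m _ (t 0) {{>-nonZero (pos 0)}}) ⟩
  t 0 * den (drop 1 t) (1 + k) + num (drop 1 t) (1 + k)  ≡⟨ den-suc t (1 + k) ⟨
  den t (2 + k)                                    ∎
  where open ≤-Reasoning

2^≤2*den² : ∀ {t} → Positive t → ∀ k → 2 ^ k ≤ 2 * (den t k * den t k)
2^≤2*den²     pos zero          = s≤s z≤n
2^≤2*den²     pos (suc zero)    = *-monoʳ-≤ 2 (*-mono-≤ (den-pos pos 1) (den-pos pos 1))
2^≤2*den² {t} pos (suc (suc k)) = begin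
  2 * (2 * 2 ^ k)              ≤⟨ *-monoʳ-≤ 2 (*-monoʳ-≤ 2 (2^≤2*den² (pos ∘ suc ∘ suc) k)) ⟩
  2 * (2 * (2 * (d * d)))      ≡⟨ regroup d ⟩
  2 * ((d + d) * (d + d))      ≤⟨ *-monoʳ-≤ 2 (*-mono-≤ (den+den≤den pos k) (den+den≤den pos k)) ⟩
  2 * (den t (2 + k) * den t (2 + k)) ∎
  where
  open ≤-Reasoning
  d = den (drop 2 t) k
  regroup : ∀ d → 2 * (2 * (2 * (d * d))) ≡ 2 * ((d + d) * (d + d))
  regroup = solve-∀

den-prev≤den : ∀ {t} → Positive t → ∀ n → proj₂ (continuant t (1 , 0) n) ≤ den t n
den-prev≤den     pos zero    = z≤n
den-prev≤den {t} pos (suc n) =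
  ≤-trans (m≤n*m (den t n) (t n) {{>-nonZero (pos n)}}) (m≤m+n _ _)

module _ {x : ℕ → ℕ} (pos : Positive x) (n k : ℕ) where
  open ≤-Reasoning

  private
    q q′ : ℕ
    q  = den x n
    q′ = proj₂ (continuant x (1 , 0) n)

    den-+ : den x (n + k) ≡ q * den (drop n x) k + q′ * num (drop n x) k
    den-+ = cong proj₁ (frac-+ x n k)

  den*den≤den-+ : den x n * den (drop n x) k ≤ den x (n + k)
  den*den≤den-+ = ≤-trans (m≤m+n _ _) (≤-reflexive (sym den-+))

  den-+≤2*den*den : den x (n + k) ≤ 2 * (den x n * den (drop n x) k)
  den-+≤2*den*den = begin
    den x (n + k)                                    ≡⟨ den-+ ⟩
    q * den (drop n x) k + q′ * num (drop n x) k
      ≤⟨ +-monoʳ-≤ _ (*-mono-≤ (den-prev≤den pos n) (num≤den (λ i → pos (n + i)) k)) ⟩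
    q * den (drop n x) k + q * den (drop n x) k      ≡⟨ cong (λ z → q * den (drop n x) k + z) (+-identityʳ _) ⟨
    2 * (q * den (drop n x) k)                       ∎

[1+M]*det≤M*[a*b] : ∀ M a c b d → c ≤ a → a ≤ suc M * c → d ≤ b → b ≤ suc M * d →
  suc M * det (a , c) (b , d) ≤ M * (a * b)
[1+M]*det≤M*[a*b] M a c b d c≤a a≤[1+M]c d≤b b≤[1+M]d = begin
  suc M * ∣ a * d - c * b ∣                ≡⟨ *-distribˡ-∣-∣ (suc M) (a * d) (c * b) ⟩
  ∣ suc M * (a * d) - suc M * (c * b) ∣    ≤⟨ ∣-∣≤∸ ab≤[1+M]ad [1+M]ad≤[1+M]ab ab≤[1+M]cb [1+M]cb≤[1+M]ab ⟩
  suc M * (a * b) ∸ a * b                  ≡⟨ m+n∸m≡n (a * b) (M * (a * b)) ⟩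
  M * (a * b)                              ∎
  where
  open ≤-Reasoning
  ab≤[1+M]ad : a * b ≤ suc M * (a * d)
  ab≤[1+M]ad = ≤-trans (*-monoʳ-≤ a b≤[1+M]d) (≤-reflexive (x∙yz≈y∙xz a (suc M) d))
  [1+M]ad≤[1+M]ab : suc M * (a * d) ≤ suc M * (a * b)
  [1+M]ad≤[1+M]ab = *-monoʳ-≤ (suc M) (*-monoʳ-≤ a d≤b)
  ab≤[1+M]cb : a * b ≤ suc M * (c * b)
  ab≤[1+M]cb = ≤-trans (*-monoˡ-≤ b a≤[1+M]c) (≤-reflexive (*-assoc (suc M) c b))
  [1+M]cb≤[1+M]ab : suc M * (c * b) ≤ suc M * (a * b)
  [1+M]cb≤[1+M]ab = *-monoʳ-≤ (suc M) (*-monoˡ-≤ b c≤a)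

[1+M]*det-frac≤M*den*den : ∀ {t w M} → Positive t → Bounded M t → Positive w → Bounded M w →
  ∀ k → suc M * det (frac t (suc k)) (frac w (suc k)) ≤ M * (den t (suc k) * den w (suc k))
[1+M]*det-frac≤M*den*den {M = M} pos-t bnd-t pos-w bnd-w k =
  [1+M]*det≤M*[a*b] M _ _ _ _ (num≤den pos-t (suc k)) (den≤[1+M]*num pos-t bnd-t k)
                              (num≤den pos-w (suc k)) (den≤[1+M]*num pos-w bnd-w k)

-- With Q, P and R, S the continuants of t and w after their first quotient, t 0 < w 0 and P ≤ Q
-- give den t k · R + Q S ≤ Q · den w k, hence Q S ≤ det; and den t k, den w k and R are at most
-- (1 + M) times Q, R and S respectively.
den*den≤[1+M]³*det-frac-< : ∀ {t w M} → Positive t → Bounded M t → Positive w → Bounded M w →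
  t 0 < w 0 → ∀ j → den t (2 + j) * den w (2 + j) ≤ suc M ^ 3 * det (frac t (2 + j)) (frac w (2 + j))
den*den≤[1+M]³*det-frac-< {t} {w} {M} pos-t bnd-t pos-w bnd-w t₀<w₀ j = begin
  den t k * den w k            ≤⟨ *-mono-≤ (den≤[1+M]*num pos-t bnd-t (1 + j)) (den≤[1+M]*num pos-w bnd-w (1 + j)) ⟩
  (suc M * num t k) * (suc M * num w k)
    ≡⟨ cong₂ (λ a b → (suc M * a) * (suc M * b)) (num-suc t (1 + j)) (num-suc w (1 + j)) ⟩
  (suc M * Q) * (suc M * R)    ≤⟨ *-monoʳ-≤ (suc M * Q) (*-monoʳ-≤ (suc M) R≤[1+M]S) ⟩
  (suc M * Q) * (suc M * (suc M * S))  ≡⟨ regroup (suc M) Q S ⟩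
  suc M ^ 3 * (Q * S)          ≤⟨ *-monoʳ-≤ (suc M ^ 3) QS≤det ⟩
  suc M ^ 3 * ∣ den t k * R - Q * den w k ∣
    ≡⟨ cong₂ (λ a b → suc M ^ 3 * ∣ den t k * a - b * den w k ∣) (num-suc w (1 + j)) (num-suc t (1 + j)) ⟨
  suc M ^ 3 * det (frac t k) (frac w k) ∎
  where
  open ≤-Reasoning
  k = 2 + j
  Q = den (drop 1 t) (1 + j)
  P = num (drop 1 t) (1 + j)
  R = den (drop 1 w) (1 + j)
  S = num (drop 1 w) (1 + j)
  regroup : ∀ m Q S → (m * Q) * (m * (m * S)) ≡ m * (m * (m * 1)) * (Q * S)
  regroup = solve-∀
  R≤[1+M]S : R ≤ suc M * S
  R≤[1+M]S = den≤[1+M]*num (pos-w ∘ suc) (bnd-w ∘ suc) j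
  cross : den t k * R + Q * S ≤ Q * den w k
  cross = begin
    den t k * R + Q * S              ≡⟨ cong (λ a → a * R + Q * S) (den-suc t (1 + j)) ⟩
    (t 0 * Q + P) * R + Q * S
      ≤⟨ +-monoˡ-≤ (Q * S) (*-monoˡ-≤ R (+-monoʳ-≤ (t 0 * Q) (num≤den (pos-t ∘ suc) (1 + j)))) ⟩
    (t 0 * Q + Q) * R + Q * S        ≡⟨ factor (t 0) Q R S ⟩
    Q * (suc (t 0) * R + S)          ≤⟨ *-monoʳ-≤ Q (+-monoˡ-≤ S (*-monoˡ-≤ R t₀<w₀)) ⟩
    Q * (w 0 * R + S)                ≡⟨ cong (Q *_) (den-suc w (1 + j)) ⟨
    Q * den w k                      ∎
    where
    factor : ∀ a Q R S → (a * Q + Q) * R + Q * S ≡ Q * (suc a * R + S)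
    factor = solve-∀
  QS≤det : Q * S ≤ ∣ den t k * R - Q * den w k ∣
  QS≤det = m+n≤o⇒n≤∣m-o∣ (den t k * R) (Q * S) (Q * den w k) cross

den*den≤[1+M]³*det-frac : ∀ {t w M} → Positive t → Bounded M t → Positive w → Bounded M w →
  t 0 ≢ w 0 → ∀ j → den t (2 + j) * den w (2 + j) ≤ suc M ^ 3 * det (frac t (2 + j)) (frac w (2 + j))
den*den≤[1+M]³*det-frac {t} {w} {M} pos-t bnd-t pos-w bnd-w t₀≢w₀ j with <-cmp (t 0) (w 0)
... | tri< t₀<w₀ _ _ = den*den≤[1+M]³*det-frac-< pos-t bnd-t pos-w bnd-w t₀<w₀ j
... | tri≈ _ t₀≡w₀ _ = contradiction t₀≡w₀ t₀≢w₀
... | tri> _ _ w₀<t₀ = subst₂ (λ a b → a ≤ suc M ^ 3 * b)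
  (*-comm (den w (2 + j)) (den t (2 + j))) (det-comm (frac w (2 + j)) (frac t (2 + j)))
  (den*den≤[1+M]³*det-frac-< pos-w bnd-w pos-t bnd-t w₀<t₀ j)

module _ {x y : ℕ → ℕ} {M : ℕ}
         (pos-x : Positive x) (bnd-x : Bounded M x) (pos-y : Positive y) (bnd-y : Bounded M y)
         (n : ℕ) (agree : ∀ i → i < n → x i ≡ y i) where
  open ≤-Reasoning

  private
    q : ℕ
    q = den x n

    b c : ℕ → ℕ
    b = drop n x
    c = drop n y

    pos-b : Positive b
    pos-b i = pos-x (n + i)
    bnd-b : Bounded M b
    bnd-b i = bnd-x (n + i)
    pos-c : Positive c
    pos-c i = pos-y (n + i)
    bnd-c : Bounded M c
    bnd-c i = bnd-y (n + i)

    den-y-prefix : den y n ≡ q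
    den-y-prefix = cong proj₁ (continuant-cong (1 , 0) n (λ i i<n → sym (agree i i<n)))

    q*den≤den-+ : ∀ k → q * den c k ≤ den y (n + k)
    q*den≤den-+ k = subst (λ z → z * den c k ≤ den y (n + k)) den-y-prefix (den*den≤den-+ pos-y n k)

    den-+≤2*q*den : ∀ k → den y (n + k) ≤ 2 * (q * den c k)
    den-+≤2*q*den k =
      subst (λ z → den y (n + k) ≤ 2 * (z * den c k)) den-y-prefix (den-+≤2*den*den pos-y n k)

  det-frac-+≤ : ∀ k → let m = n + suc k in
    det (frac x m) (frac y m) * (suc M * (q * q)) ≤ M * (den x m * den y m)
  det-frac-+≤ k = begin
    det (frac x m) (frac y m) * (suc M * (q * q))  ≡⟨ *-comm (det (frac x m) (frac y m)) _ ⟩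
    suc M * (q * q) * det (frac x m) (frac y m)    ≡⟨ cong (suc M * (q * q) *_) (det-common-prefix x y n k′ agree) ⟩
    suc M * (q * q) * D                            ≡⟨ xy∙z≈y∙xz (suc M) (q * q) D ⟩
    (q * q) * (suc M * D)                          ≤⟨ *-monoʳ-≤ (q * q) ([1+M]*det-frac≤M*den*den pos-b bnd-b pos-c bnd-c k) ⟩
    (q * q) * (M * (den b k′ * den c k′))          ≡⟨ distribute-q M q (den b k′) (den c k′) ⟩
    M * ((q * den b k′) * (q * den c k′))          ≤⟨ *-monoʳ-≤ M (*-mono-≤ (den*den≤den-+ pos-x n k′) (q*den≤den-+ k′)) ⟩
    M * (den x m * den y m)                        ∎
    where
    k′ = suc k
    m = n + k′
    D = det (frac b k′) (frac c k′)
    distribute-q : ∀ M q B C → (q * q) * (M * (B * C)) ≡ M * ((q * B) * (q * C))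
    distribute-q = solve-∀

  den*den≤det-frac-+ : x n ≢ y n → ∀ j → let m = n + (2 + j) in
    den x m * den y m ≤ det (frac x m) (frac y m) * (4 * suc M ^ 3 * (q * q))
  den*den≤det-frac-+ xₙ≢yₙ j = begin
    den x m * den y m                          ≤⟨ *-mono-≤ (den-+≤2*den*den pos-x n k) (den-+≤2*q*den k) ⟩
    (2 * (q * den b k)) * (2 * (q * den c k))  ≡⟨ collect-q q (den b k) (den c k) ⟩
    4 * (q * q) * (den b k * den c k)
      ≤⟨ *-monoʳ-≤ (4 * (q * q)) (den*den≤[1+M]³*det-frac pos-b bnd-b pos-c bnd-c b₀≢c₀ j) ⟩
    4 * (q * q) * (suc M ^ 3 * D)              ≡⟨ regroup q (suc M ^ 3) D ⟩
    D * (4 * suc M ^ 3 * (q * q))              ≡⟨ cong (_* (4 * suc M ^ 3 * (q * q))) (det-common-prefix x y n k agree) ⟨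
    det (frac x m) (frac y m) * (4 * suc M ^ 3 * (q * q)) ∎
    where
    k = 2 + j
    m = n + k
    D = det (frac b k) (frac c k)
    b₀≢c₀ : b 0 ≢ c 0
    b₀≢c₀ = subst₂ (λ i i′ → x i ≢ y i′) (sym (+-identityʳ n)) (sym (+-identityʳ n)) xₙ≢yₙ
    collect-q : ∀ q B C → (2 * (q * B)) * (2 * (q * C)) ≡ 4 * (q * q) * (B * C)
    collect-q = solve-∀
    regroup : ∀ q K D → 4 * (q * q) * (K * D) ≡ D * (4 * K * (q * q))
    regroup = solve-∀

-- m ⁄ 0 is m / 1; all uses below have a positive denominator.
_⁄_ : ℕ → ℕ → ℚᵘ
m ⁄ n = mkℚᵘ (+ m) (n ∸ 1)

⁄≤⁄ : ∀ {a b c d} → 1 ≤ b → 1 ≤ d → a * d ≤ c * b → a ⁄ b ℚ.≤ c ⁄ d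
⁄≤⁄ {a} {suc b} {c} {suc d} (s≤s z≤n) (s≤s z≤n) ad≤cb =
  ℚ.*≤* (subst₂ ℤ._≤_ (ℤ.pos-* a (suc d)) (ℤ.pos-* c (suc b)) (ℤ.+≤+ ad≤cb))

⁄<⁄ : ∀ {a b c d} → 1 ≤ b → 1 ≤ d → a * d < c * b → a ⁄ b ℚ.< c ⁄ d
⁄<⁄ {a} {suc b} {c} {suc d} (s≤s z≤n) (s≤s z≤n) ad<cb =
  ℚ.*<* (subst₂ ℤ._<_ (ℤ.pos-* a (suc d)) (ℤ.pos-* c (suc b)) (ℤ.+<+ ad<cb))

+[a*u+v] : ∀ a u v → + (a * u + v) ≡ + a ℤ.* + u ℤ.+ + v
+[a*u+v] a u v = trans (ℤ.pos-+ (a * u) v) (cong (ℤ._+ + v) (ℤ.pos-* a u))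

pqᶜ : ℤ → ℕ × ℕ → ℕ × ℕ → (ℤ × ℕ) × (ℤ × ℕ)
pqᶜ a₀ (q , q′) (s , s′) = (a₀ ℤ.* + q ℤ.+ + s , q) , (a₀ ℤ.* + q′ ℤ.+ + s′ , q′)

pqᶜ-step : ∀ a₀ a σ τ →
  + a ℤ.* (a₀ ℤ.* + proj₁ σ ℤ.+ + proj₁ τ) ℤ.+ (a₀ ℤ.* + proj₂ σ ℤ.+ + proj₂ τ)
    ≡ a₀ ℤ.* + proj₁ (step a σ) ℤ.+ + proj₁ (step a τ)
pqᶜ-step a₀ a (s , s′) (r , r′) = begin
  + a ℤ.* (a₀ ℤ.* + s ℤ.+ + r) ℤ.+ (a₀ ℤ.* + s′ ℤ.+ + r′)
    ≡⟨ regroup a₀ (+ a) (+ s) (+ s′) (+ r) (+ r′) ⟩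
  a₀ ℤ.* (+ a ℤ.* + s ℤ.+ + s′) ℤ.+ (+ a ℤ.* + r ℤ.+ + r′)
    ≡⟨ cong₂ (λ u v → a₀ ℤ.* u ℤ.+ v) (+[a*u+v] a s s′) (+[a*u+v] a r r′) ⟨
  a₀ ℤ.* + (a * s + s′) ℤ.+ + (a * r + r′)
    ∎
  where
  open ≡-Reasoning
  regroup : ∀ a₀ a s s′ r r′ →
    a ℤ.* (a₀ ℤ.* s ℤ.+ r) ℤ.+ (a₀ ℤ.* s′ ℤ.+ r′) ≡ a₀ ℤ.* (a ℤ.* s ℤ.+ s′) ℤ.+ (a ℤ.* r ℤ.+ r′)
  regroup = ℤ-Solver.solve-∀

pq≡pqᶜ : ∀ a₀ x m → pq a₀ x m ≡ pqᶜ a₀ (continuant x (1 , 0) m) (continuant x (0 , 1) m)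
pq≡pqᶜ a₀ x zero    = cong₂ (λ p p′ → (p , 1) , (p′ , 0)) (initial₀ a₀) (initial₋₁ a₀)
  where
  initial₀ : ∀ a₀ → a₀ ≡ a₀ ℤ.* + 1 ℤ.+ + 0
  initial₀ = ℤ-Solver.solve-∀
  initial₋₁ : ∀ a₀ → + 1 ≡ a₀ ℤ.* + 0 ℤ.+ + 1
  initial₋₁ = ℤ-Solver.solve-∀
pq≡pqᶜ a₀ x (suc m) rewrite pq≡pqᶜ a₀ x m =
  cong (λ p → (p , proj₁ (step (x m) σ)) , proj₁ (pqᶜ a₀ σ τ)) (pqᶜ-step a₀ (x m) σ τ)
  where
  σ = continuant x (1 , 0) m
  τ = continuant x (0 , 1) m

convergent≡ : ∀ a₀ x m → convergent a₀ x m ≡ mkℚᵘ (a₀ ℤ.* + den x m ℤ.+ + num x m) (den x m ∸ 1)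
convergent≡ a₀ x m = cong (λ r → mkℚᵘ (proj₁ (proj₁ r)) (proj₂ (proj₁ r) ∸ 1)) (pq≡pqᶜ a₀ x m)

∣mixed-mixed∣ : ∀ a₀ u w → 1 ≤ proj₁ u → 1 ≤ proj₁ w →
  ℚ.∣ mkℚᵘ (a₀ ℤ.* + proj₁ u ℤ.+ + proj₂ u) (proj₁ u ∸ 1)
      ℚ.- mkℚᵘ (a₀ ℤ.* + proj₁ w ℤ.+ + proj₂ w) (proj₁ w ∸ 1) ∣
    ≡ det u w ⁄ (proj₁ u * proj₁ w)
∣mixed-mixed∣ a₀ u@(suc a , c) w@(suc b , d) (s≤s z≤n) (s≤s z≤n) =
  cong (λ n → mkℚᵘ (+ n) (b + a * suc b)) (begin
  ℤ.∣ (a₀ ℤ.* A ℤ.+ C) ℤ.* B ℤ.+ ℤ.- (a₀ ℤ.* B ℤ.+ D) ℤ.* A ∣  ≡⟨ cong ℤ.∣_∣ (cancel-a₀ a₀ A B C D) ⟩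
  ℤ.∣ ℤ.- (A ℤ.* D ℤ.- C ℤ.* B) ∣                               ≡⟨ ℤ.∣-i∣≡∣i∣ (A ℤ.* D ℤ.- C ℤ.* B) ⟩
  ℤ.∣ A ℤ.* D ℤ.- C ℤ.* B ∣                                     ≡⟨ det≡∣det∣ u w ⟨
  det u w                                                       ∎)
  where
  open ≡-Reasoning
  A = + suc a ; B = + suc b ; C = + c ; D = + d
  cancel-a₀ : ∀ a₀ A B C D →
    (a₀ ℤ.* A ℤ.+ C) ℤ.* B ℤ.+ ℤ.- (a₀ ℤ.* B ℤ.+ D) ℤ.* A ≡ ℤ.- (A ℤ.* D ℤ.- C ℤ.* B)
  cancel-a₀ = ℤ-Solver.solve-∀

∣convergent-convergent∣ : ∀ a₀ {x y} → Positive x → Positive y → ∀ m →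
  ℚ.∣ convergent a₀ x m ℚ.- convergent a₀ y m ∣ ≡ det (frac x m) (frac y m) ⁄ (den x m * den y m)
∣convergent-convergent∣ a₀ {x} {y} pos-x pos-y m =
  trans (cong₂ (λ r r′ → ℚ.∣ r ℚ.- r′ ∣) (convergent≡ a₀ x m) (convergent≡ a₀ y m))
        (∣mixed-mixed∣ a₀ (frac x m) (frac y m) (den-pos pos-x m) (den-pos pos-y m))

5^[2[n+2]]≡625*5ⁿ*5ⁿ : ∀ n → 5 ^ (2 * (n + 2)) ≡ 625 * (5 ^ n * 5 ^ n)
5^[2[n+2]]≡625*5ⁿ*5ⁿ n = begin
  5 ^ ((n + 2) + ((n + 2) + 0))    ≡⟨ ^-distribˡ-+-* 5 (n + 2) _ ⟩
  5 ^ (n + 2) * 5 ^ ((n + 2) + 0)  ≡⟨ cong (λ e → 5 ^ (n + 2) * 5 ^ e) (+-identityʳ (n + 2)) ⟩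
  5 ^ (n + 2) * 5 ^ (n + 2)        ≡⟨ cong₂ _*_ (^-distribˡ-+-* 5 n 2) (^-distribˡ-+-* 5 n 2) ⟩
  (5 ^ n * 25) * (5 ^ n * 25)      ≡⟨ regroup (5 ^ n) ⟩
  625 * (5 ^ n * 5 ^ n)            ∎
  where
  open ≡-Reasoning
  regroup : ∀ f → (f * 25) * (f * 25) ≡ 625 * (f * f)
  regroup = solve-∀

δ<1⁄500q² : ∀ n q → 1 ≤ q → q ≤ 5 ^ n → δ n ℚ.< 1 ⁄ (500 * (q * q))
δ<1⁄500q² n q 1≤q q≤5ⁿ =
  ⁄<⁄ (m^n>0 5 (2 * (n + 2))) (*-mono-≤ {1} {500} (s≤s z≤n) 1≤q²) (begin-strict
  1 * (500 * (q * q))          ≡⟨ *-identityˡ _ ⟩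
  500 * (q * q)                ≤⟨ *-monoʳ-≤ 500 (*-mono-≤ q≤5ⁿ q≤5ⁿ) ⟩
  500 * (5 ^ n * 5 ^ n)        <⟨ *-monoˡ-< (5 ^ n * 5 ^ n) {{>-nonZero 1≤25ⁿ}} (m<m+n 500 {125} (s≤s z≤n)) ⟩
  625 * (5 ^ n * 5 ^ n)        ≡⟨ 5^[2[n+2]]≡625*5ⁿ*5ⁿ n ⟨
  5 ^ (2 * (n + 2))            ≡⟨ *-identityˡ _ ⟨
  1 * 5 ^ (2 * (n + 2))        ∎)
  where
  open ≤-Reasoning
  1≤q² : 1 ≤ q * q
  1≤q² = *-mono-≤ 1≤q 1≤q
  1≤25ⁿ : 1 ≤ 5 ^ n * 5 ^ n
  1≤25ⁿ = *-mono-≤ (m^n>0 5 n) (m^n>0 5 n)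

4⁄5q²<ε : ∀ n q → 1 ≤ q → 2 ^ n ≤ 2 * (q * q) → 4 ⁄ (5 * (q * q)) ℚ.< ε n
4⁄5q²<ε zero q 1≤q _ = ⁄<⁄ 1≤5q² ≤-refl (begin-strict
  4 * 1                  <⟨ m<m+n 4 {6} (s≤s z≤n) ⟩
  2 * (5 * 1)            ≤⟨ *-monoʳ-≤ 2 (*-monoʳ-≤ 5 1≤q²) ⟩
  2 * (5 * (q * q))      ∎)
  where
  open ≤-Reasoning
  1≤q² = *-mono-≤ 1≤q 1≤q
  1≤5q² = *-mono-≤ {1} {5} (s≤s z≤n) 1≤q²
4⁄5q²<ε (suc n) q 1≤q 2ⁿ⁺¹≤2q² = ⁄<⁄ 1≤5q² (m^n>0 2 n) (begin-strict
  4 * 2 ^ n              ≤⟨ *-monoʳ-≤ 4 (*-cancelˡ-≤ {2 ^ n} {q * q} 2 2ⁿ⁺¹≤2q²) ⟩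
  4 * (q * q)            <⟨ *-monoˡ-< (q * q) {{>-nonZero 1≤q²}} (n<1+n 4) ⟩
  5 * (q * q)            ≡⟨ *-identityˡ _ ⟨
  1 * (5 * (q * q))      ∎)
  where
  open ≤-Reasoning
  1≤q² = *-mono-≤ 1≤q 1≤q
  1≤5q² = *-mono-≤ {1} {5} (s≤s z≤n) 1≤q²


from-n+2 : ∀ {P : ℕ → Set} n → (∀ j → P (n + (2 + j))) → ∀ m → n + 2 ≤ m → P m
from-n+2 {P} n P[n+2+j] m n+2≤m =
  subst P (trans (sym (+-assoc n 2 (m ∸ (n + 2)))) (m+[n∸m]≡n n+2≤m)) (P[n+2+j] (m ∸ (n + 2)))

convergents-apart : ∀ {x y} n a₀ → Positive x → Bounded 4 x → Positive y → Bounded 4 y →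
  (∀ i → i < n → x i ≡ y i) → x n ≢ y n →
  LimDist> (convergent a₀ x) (convergent a₀ y) (δ n) × LimDist< (convergent a₀ x) (convergent a₀ y) (ε n)
convergents-apart {x} {y} n a₀ pos-x bnd-x pos-y bnd-y agree xₙ≢yₙ =
  (1 ⁄ (500 * (q * q)) , δ<1⁄500q² n q 1≤q (den≤[1+M]^ pos-x bnd-x n) , n + 2 , from-n+2 n below) ,
  (4 ⁄ (5 * (q * q)) , 4⁄5q²<ε n q 1≤q (2^≤2*den² pos-x n) , n + 2 , from-n+2 n above)
  where
  q = den x n
  1≤q = den-pos pos-x n
  1≤q² = *-mono-≤ 1≤q 1≤q
  dist : ℕ → ℚᵘ
  dist m = ℚ.∣ convergent a₀ x m ℚ.- convergent a₀ y m ∣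
  1≤den*den : ∀ m → 1 ≤ den x m * den y m
  1≤den*den m = *-mono-≤ (den-pos pos-x m) (den-pos pos-y m)
  below : ∀ j → 1 ⁄ (500 * (q * q)) ℚ.≤ dist (n + (2 + j))
  below j rewrite ∣convergent-convergent∣ a₀ pos-x pos-y (n + (2 + j)) =
    ⁄≤⁄ (*-mono-≤ {1} {500} (s≤s z≤n) 1≤q²) (1≤den*den (n + (2 + j)))
        (≤-trans (≤-reflexive (*-identityˡ _)) (den*den≤det-frac-+ pos-x bnd-x pos-y bnd-y n agree xₙ≢yₙ j))
  above : ∀ j → dist (n + (2 + j)) ℚ.≤ 4 ⁄ (5 * (q * q))
  above j rewrite ∣convergent-convergent∣ a₀ pos-x pos-y (n + (2 + j)) =
    ⁄≤⁄ (1≤den*den (n + (2 + j))) (*-mono-≤ {1} {5} (s≤s z≤n) 1≤q²)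
        (det-frac-+≤ pos-x bnd-x pos-y bnd-y n agree (suc j))

module _ {n : ℕ} (a : Vec ℕ n) where

  splice-prefix : ∀ t t′ i → i < n → splice a t i ≡ splice a t′ i
  splice-prefix t t′ i i<n with i <? n
  ... | yes _   = refl
  ... | no  i≮n = contradiction i<n i≮n

  splice-+ : ∀ t i → splice a t (n + i) ≡ t i
  splice-+ t i with n + i <? n
  ... | yes n+i<n = contradiction (m≤m+n n i) (<⇒≱ n+i<n)
  ... | no  _     = cong t (m+n∸m≡n n i)

  splice-all : ∀ {P : ℕ → Set} t → All P a → (∀ i → P (t i)) → ∀ k → P (splice a t k)
  splice-all t Pa Pt k with k <? n
  ... | yes k<n = lookup⁺ Pa (fromℕ< k<n)
  ... | no  _   = Pt (k ∸ n)

lemma7 : (n : ℕ) (a₀ : ℤ) (a : Vec ℕ n) (b c : ℕ → ℕ)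
         → All (λ x → 1 ≤ x) a → (∀ i → 1 ≤ b i) → (∀ i → 1 ≤ c i)
         → b 0 ≢ c 0
         → All (λ x → x ≤ 4) a → (∀ i → b i ≤ 4) → (∀ i → c i ≤ 4)
         → LimDist> (convergent a₀ (splice a b)) (convergent a₀ (splice a c)) (δ n)
           × LimDist< (convergent a₀ (splice a b)) (convergent a₀ (splice a c)) (ε n)
lemma7 n a₀ a b c pos-a pos-b pos-c b₀≢c₀ bnd-a bnd-b bnd-c =
  convergents-apart n a₀
    (splice-all a b pos-a pos-b) (splice-all a b bnd-a bnd-b)
    (splice-all a c pos-a pos-c) (splice-all a c bnd-a bnd-c)
    (splice-prefix a b c) xₙ≢yₙ
  where
  xₙ≢yₙ : splice a b n ≢ splice a c n
  xₙ≢yₙ = subst₂ (λ i i′ → splice a b i ≢ splice a c i′) (+-identityʳ n) (+-identityʳ n)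
            (subst₂ _≢_ (sym (splice-+ a b 0)) (sym (splice-+ a c 0)) b₀≢c₀)
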